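{- For all integers $v\ge4$ and $d\ge1$, \[\sum_{D\in\mathcal{D}_{v,d}(231,312,321)} x^{des(\pi_D)} = (1+x)^{d-1}\left(\sum_{k=0}^{\lfloor\frac{v-2}{2}\rfloor}\binom{v-2-k}{k}x^k\right)^{d}.\]
   Context: A diamond with $v$ vertices ($v\ge4$) is the poset with a least element, a greatest element, and $v-2$ pairwise incomparable middle elements (in a fixed left-to-right order) strictly between them. $\mathcal{D}_{v,d}$ is the set of labellings of $d$ diamonds (placed left to right) by $1,\dots,vd$, each label used once, such that in each diamond least label $<$ each middle label $<$ greatest label. For $D\in\mathcal{D}_{v,d}$, $\pi_D$ is the permutation obtained by reading the diamonds left to right and, within each diamond, the least element, then the middle elements left to right, then the greatest element. $\mathcal{D}_{v,d}(P)$ is the set of $D$ with $\pi_D$ avoiding every classical pattern in $P$. $des(\pi)$ is the number of $i$ with $\pi_i>\pi_{i+1}$. -}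

module Defs where

open import Data.Nat using (ℕ; zero; suc; _+_; _*_; _∸_; _^_; _<ᵇ_; _≡ᵇ_; _/_)
open import Data.Nat.Combinatorics using (_C_)
open import Data.Bool using (Bool; true; false; _∧_; _∨_; not; if_then_else_)
open import Data.List using (List; []; _∷_; map; concatMap; filter; length; upTo; take; drop; _++_; zipWith)
open import Data.Bool.ListAction using (all; any)
open import Data.Nat.ListAction using (sum)
open import Data.Bool.Properties using (T?)

_⇔ᵇ_ : Bool → Bool → Bool
true ⇔ᵇ b = b
false ⇔ᵇ b = not b

insertAll : ℕ → List ℕ → List (List ℕ)
insertAll x [] = (x ∷ []) ∷ []
insertAll x (y ∷ ys) = (x ∷ y ∷ ys) ∷ map (y ∷_) (insertAll x ys)

perms : List ℕ → List (List ℕ)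
perms [] = [] ∷ []
perms (x ∷ xs) = concatMap (insertAll x) (perms xs)

oneTo : ℕ → List ℕ
oneTo n = map suc (upTo n)

-- A labelling D ∈ D_{v,d} is identified with its reading word π_D
-- (a permutation of 1..vd): block i (positions iv+1..iv+v) lists
-- least, middles (left to right), greatest of diamond i.

lastOf : ℕ → List ℕ → ℕ
lastOf y [] = y
lastOf _ (z ∷ zs) = lastOf z zs

blockRest : ℕ → List ℕ → Bool
blockRest a [] = false
blockRest a (b ∷ []) = a <ᵇ b
blockRest a (m ∷ c ∷ cs) = (a <ᵇ m) ∧ (m <ᵇ lastOf c cs) ∧ blockRest a (c ∷ cs)

blockOK : List ℕ → Bool
blockOK [] = false
blockOK (a ∷ rest) = blockRest a rest

diamondsOK : ℕ → ℕ → List ℕ → Bool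
diamondsOK v zero w = true
diamondsOK v (suc d) w = blockOK (take v w) ∧ diamondsOK v d (drop v w)

subseqs : ℕ → List ℕ → List (List ℕ)
subseqs zero _ = [] ∷ []
subseqs (suc k) [] = []
subseqs (suc k) (x ∷ xs) = map (x ∷_) (subseqs k xs) ++ subseqs (suc k) xs

orderIso : List ℕ → List ℕ → Bool
orderIso [] [] = true
orderIso (a ∷ as) (p ∷ ps) =
  all (λ b → b) (zipWith (λ b q → ((a <ᵇ b) ⇔ᵇ (p <ᵇ q)) ∧ ((b <ᵇ a) ⇔ᵇ (q <ᵇ p))) as ps)
  ∧ orderIso as ps
orderIso _ _ = false

contains : List ℕ → List ℕ → Bool
contains π p = any (λ s → orderIso s p) (subseqs (length p) π)

avoidsAll : List (List ℕ) → List ℕ → Bool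
avoidsAll P π = all (λ p → not (contains π p)) P

des : List ℕ → ℕ
des [] = 0
des (a ∷ []) = 0
des (a ∷ b ∷ w) = (if b <ᵇ a then 1 else 0) + des (b ∷ w)

diamondWords : ℕ → ℕ → List (List ℕ) → List (List ℕ)
diamondWords v d P =
  filter (λ w → T? (diamondsOK v d w ∧ avoidsAll P w)) (perms (oneTo (v * d)))

lhsCoeff : ℕ → ℕ → List (List ℕ) → ℕ → ℕ
lhsCoeff v d P n = length (filter (λ w → T? (des w ≡ᵇ n)) (diamondWords v d P))

-- Polynomials with ℕ coefficients as coefficient functions ℕ → ℕ

Poly : Set
Poly = ℕ → ℕ

polyMul : Poly → Poly → Poly
polyMul p q n = sum (map (λ i → p i * q (n ∸ i)) (upTo (suc n)))

polyOne : Poly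
polyOne zero = 1
polyOne (suc _) = 0

polyPow : Poly → ℕ → Poly
polyPow p zero = polyOne
polyPow p (suc m) = polyMul p (polyPow p m)

onePlusX : Poly
onePlusX zero = 1
onePlusX (suc zero) = 1
onePlusX (suc (suc _)) = 0

fibPoly : ℕ → Poly
fibPoly v k = if (v ∸ 2) / 2 <ᵇ k then 0 else ((v ∸ 2) ∸ k) C k

rhs : ℕ → ℕ → Poly
rhs v d = polyMul (polyPow onePlusX (d ∸ 1)) (polyPow (fibPoly v) d)

P231-312-321 : List (List ℕ)
P231-312-321 = (2 ∷ 3 ∷ 1 ∷ []) ∷ (3 ∷ 1 ∷ 2 ∷ []) ∷ (3 ∷ 2 ∷ 1 ∷ []) ∷ []

-- The permutations avoiding 231, 312 and 321 are the layered permutations with layers of size at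
-- most two: they are read off tilings of a strip by squares (layers of size one) and dominoes
-- (decreasing layers of size two, each giving one descent). A reading word of d diamonds is such a
-- permutation exactly when its tiling starts with a square (the least element of the first
-- diamond), ends with a square (the greatest element of the last one), tiles the v - 2 middle
-- elements of each diamond separately, and covers each greatest element together with the next
-- least element by two squares or by a domino. Counting dominoes, each middle contributes
-- Σₖ C(v-2-k, k) xᵏ and each of the d - 1 junctions contributes 1 + x.

module Submission where

open import Defs
open import Data.Bool using (Bool; true; false; T; not; _∧_; if_then_else_)
open import Data.Bool.Properties using (T-∧; T?)
open import Data.Unit using (tt)
open import Data.Empty using (⊥-elim)
open import Data.Product using (∃; ∃₂; _×_; _,_; proj₁; proj₂; uncurry)
open import Data.Sum using (_⊎_; inj₁; inj₂)
open import Data.Nat using (ℕ; zero; suc; _+_; _*_; _∸_; _/_; _≤_; _<_; _<ᵇ_; _≡ᵇ_; _≟_; z≤n; s≤s; z<s)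
open import Data.Nat.Properties
open import Data.Nat.DivMod using (m*n/n≡m; /-monoˡ-≤)
open import Data.Nat.Combinatorics using (_C_; nCk+nC[k+1]≡[n+1]C[k+1])
open import Data.Nat.Combinatorics.Specification using (k>n⇒nCk≡0)
open import Data.Nat.ListAction using (sum)
open import Data.Nat.ListAction.Properties using (sum-++)
open import Data.Nat.Tactic.RingSolver using (solve-∀)
open import Data.List
  using (List; []; _∷_; _++_; map; concatMap; filter; length; take; drop; upTo; applyUpTo; cartesianProduct)
open import Data.List.Properties
  using (map-applyUpTo; map-cong; map-++; upTo-∷ʳ; length-++; filter-++; ++-assoc; ∷-injective; ∷-injectiveʳ)
open import Data.List.Membership.Propositional using (_∈_; _∉_; find; lose)
open import Data.List.Membership.Propositional.Properties
  using (∈-map⁺; ∈-map⁻; ∈-++⁺ˡ; ∈-++⁺ʳ; ∈-++⁻; ∈-∃++; ∈-concatMap⁺; ∈-concatMap⁻;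
         ∈-filter⁺; ∈-filter⁻; ∈-cartesianProduct⁺; ∈-cartesianProduct⁻)
open import Data.List.Membership.Propositional.Properties.WithK using (unique∧set⇒bag)
open import Data.List.Relation.Unary.Any using (here; there)
import Data.List.Relation.Unary.Any as Any
open import Data.List.Relation.Unary.Any.Properties using (any⁺; any⁻)
open import Data.List.Relation.Unary.All using (All; []; _∷_)
import Data.List.Relation.Unary.All as All
import Data.List.Relation.Unary.All.Properties as Allₚ
open import Data.List.Relation.Unary.AllPairs using ([]; _∷_)
open import Data.List.Relation.Unary.Unique.Propositional using (Unique)
open import Data.List.Relation.Unary.Unique.Propositional.Properties using (++⁺; map⁺; cartesianProduct⁺; filter⁺)
open import Data.List.Relation.Binary.Permutation.Propositional
  using (_↭_; ↭-refl; ↭-trans; ↭-sym; prep; swap; ↭⇒↭ₛ)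
open import Data.List.Relation.Binary.Permutation.Propositional.Properties
  using (↭-empty-inv; ↭-length; ∈-resp-↭; shift; drop-∷; filter-↭)
import Data.List.Relation.Binary.Permutation.Setoid.Properties as ↭ₛ
open import Data.List.Relation.Binary.BagAndSetEquality using (∼bag⇒↭)
open import Data.List.Relation.Binary.Sublist.Propositional
  using (_⊆_; []; _∷_; _∷ʳ_; minimum; ⊆-trans; from∈; to∈)
open import Data.Vec using (Vec; []; _∷_)
import Data.Vec as Vec
import Data.Vec.Properties as Vec
import Data.Vec.Relation.Unary.All as VecAll
open VecAll using ([]; _∷_)
open import Function using (Equivalence; mk⇔; _∘′_; case_of_)
open import Relation.Nullary using (¬_; yes; no)
open import Relation.Binary.Definitions using (tri<; tri≈; tri>)
open import Relation.Binary.PropositionalEquality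

∧-intro : ∀ {x y} → T x → T y → T (x ∧ y)
∧-intro tx ty = Equivalence.from T-∧ (tx , ty)

∧-elim : ∀ {x y} → T (x ∧ y) → T x × T y
∧-elim = Equivalence.to T-∧

<ᵇ-false : ∀ {m n} → n ≤ m → (m <ᵇ n) ≡ false
<ᵇ-false z≤n = refl
<ᵇ-false (s≤s n≤m) = <ᵇ-false n≤m

<ᵇ-true : ∀ {m n} → m < n → (m <ᵇ n) ≡ true
<ᵇ-true (s≤s z≤n) = refl
<ᵇ-true (s≤s (s≤s m<n)) = <ᵇ-true (s≤s m<n)

≡ᵇ-refl : ∀ n → (n ≡ᵇ n) ≡ true
≡ᵇ-refl zero = refl
≡ᵇ-refl (suc n) = ≡ᵇ-refl n

≡ᵇ-false : ∀ {m n} → m ≢ n → (m ≡ᵇ n) ≡ false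
≡ᵇ-false {m} {n} m≢n with m ≡ᵇ n in eq
... | true = ⊥-elim (m≢n (≡ᵇ⇒≡ m n (subst T (sym eq) _)))
... | false = refl

module _ {A B : Set} where

  concatMap-unique : ∀ (f : A → List B) {L} → Unique L → (∀ {y} → y ∈ L → Unique (f y)) →
    (∀ {y y′ z} → y ∈ L → y′ ∈ L → z ∈ f y → z ∈ f y′ → y ≡ y′) →
    Unique (concatMap f L)
  concatMap-unique f {[]} _ _ _ = []
  concatMap-unique f {y ∷ L} (y∉L ∷ uL) uf dj =
    ++⁺ (uf (here refl)) (concatMap-unique f uL (uf ∘′ there) (λ i j → dj (there i) (there j)))
      λ (p , q) → let _ , i , r = find (∈-concatMap⁻ f {xs = L} q)
                  in All.lookup y∉L i (dj (here refl) (there i) p r)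

  map-unique : ∀ (f : A → B) {L} → Unique L →
    (∀ {x y} → x ∈ L → y ∈ L → f x ≡ f y → x ≡ y) → Unique (map f L)
  map-unique f {[]} _ _ = []
  map-unique f {x ∷ L} (x∉L ∷ uL) inj =
    Allₚ.map⁺ (All.tabulate λ y∈L e → All.lookup x∉L y∈L (inj (here refl) (there y∈L) e))
      ∷ map-unique f uL (λ i j → inj (there i) (there j))

Unique-resp-↭ : ∀ {A : Set} {xs ys : List A} → Unique xs → xs ↭ ys → Unique ys
Unique-resp-↭ {A} u p = ↭ₛ.Unique-resp-↭ (setoid A) (↭⇒↭ₛ p) u

module _ {A : Set} where

  take-++-length : ∀ (xs ys : List A) k → take (length xs + k) (xs ++ ys) ≡ xs ++ take k ys
  take-++-length [] ys k = refl
  take-++-length (x ∷ xs) ys k = cong (x ∷_) (take-++-length xs ys k)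

  drop-++-length : ∀ (xs ys : List A) k → drop (length xs + k) (xs ++ ys) ≡ drop k ys
  drop-++-length [] ys k = refl
  drop-++-length (x ∷ xs) ys k = drop-++-length xs ys k

  ∈⇒pair-⊆ : ∀ {x y} {w : List A} → x ∈ w → y ∈ w → x ≢ y → x ∷ y ∷ [] ⊆ w ⊎ y ∷ x ∷ [] ⊆ w
  ∈⇒pair-⊆ (here refl) (here refl) x≢y = ⊥-elim (x≢y refl)
  ∈⇒pair-⊆ (here refl) (there j) _ = inj₁ (refl ∷ from∈ j)
  ∈⇒pair-⊆ (there i) (here refl) _ = inj₂ (refl ∷ from∈ i)
  ∈⇒pair-⊆ {w = z ∷ _} (there i) (there j) x≢y with ∈⇒pair-⊆ i j x≢y
  ... | inj₁ u = inj₁ (z ∷ʳ u)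
  ... | inj₂ u = inj₂ (z ∷ʳ u)

  pairs-⊆ : ∀ {a b c} {w : List A} → a ∷ b ∷ c ∷ [] ⊆ w →
    a ∷ b ∷ [] ⊆ w × a ∷ c ∷ [] ⊆ w × b ∷ c ∷ [] ⊆ w
  pairs-⊆ {a} {b} {c} u =
    ⊆-trans (refl ∷ refl ∷ c ∷ʳ []) u , ⊆-trans (refl ∷ b ∷ʳ refl ∷ []) u , ⊆-trans (a ∷ʳ refl ∷ refl ∷ []) u

∈-insertAll⇒↭ : ∀ x ys {w} → w ∈ insertAll x ys → w ↭ x ∷ ys
∈-insertAll⇒↭ x [] (here refl) = ↭-refl
∈-insertAll⇒↭ x (y ∷ ys) (here refl) = ↭-refl
∈-insertAll⇒↭ x (y ∷ ys) (there p) with _ , q , refl ← ∈-map⁻ (y ∷_) p =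
  ↭-trans (prep y (∈-insertAll⇒↭ x ys q)) (swap y x ↭-refl)

∈-insertAll⁺ : ∀ x as bs → as ++ x ∷ bs ∈ insertAll x (as ++ bs)
∈-insertAll⁺ x [] [] = here refl
∈-insertAll⁺ x [] (_ ∷ _) = here refl
∈-insertAll⁺ x (a ∷ as) bs = there (∈-map⁺ (a ∷_) (∈-insertAll⁺ x as bs))

∈-perms⇒↭ : ∀ xs {w} → w ∈ perms xs → w ↭ xs
∈-perms⇒↭ [] (here refl) = ↭-refl
∈-perms⇒↭ (x ∷ xs) p with ys , i , q ← find (∈-concatMap⁻ (insertAll x) {xs = perms xs} p) =
  ↭-trans (∈-insertAll⇒↭ x ys q) (prep x (∈-perms⇒↭ xs i))

↭⇒∈-perms : ∀ xs {w} → w ↭ xs → w ∈ perms xs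
↭⇒∈-perms [] p rewrite ↭-empty-inv p = here refl
↭⇒∈-perms (x ∷ xs) p with as , bs , refl ← ∈-∃++ (∈-resp-↭ (↭-sym p) (here refl)) =
  ∈-concatMap⁺ (insertAll x)
    (Any.map (λ { refl → ∈-insertAll⁺ x as bs }) (↭⇒∈-perms xs (drop-∷ (↭-trans (↭-sym (shift x as bs)) p))))

remove : ℕ → List ℕ → List ℕ
remove x [] = []
remove x (y ∷ ys) with x ≟ y
... | yes _ = ys
... | no _ = y ∷ remove x ys

remove-insertAll : ∀ x ys {w} → x ∉ ys → w ∈ insertAll x ys → remove x w ≡ ys
remove-insertAll x [] _ (here refl) with x ≟ x
... | yes _ = refl
... | no x≢x = ⊥-elim (x≢x refl)
remove-insertAll x (y ∷ ys) _ (here refl) with x ≟ x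
... | yes _ = refl
... | no x≢x = ⊥-elim (x≢x refl)
remove-insertAll x (y ∷ ys) x∉ (there p) with _ , q , refl ← ∈-map⁻ (y ∷_) p | x ≟ y
... | yes refl = ⊥-elim (x∉ (here refl))
... | no _ = cong (y ∷_) (remove-insertAll x ys (x∉ ∘′ there) q)

insertAll-unique : ∀ x ys → x ∉ ys → Unique (insertAll x ys)
insertAll-unique x [] _ = [] ∷ []
insertAll-unique x (y ∷ ys) x∉ =
  Allₚ.map⁺ (All.tabulate λ _ → λ { refl → x∉ (here refl) })
    ∷ map⁺ (λ { refl → refl }) (insertAll-unique x ys (x∉ ∘′ there))

perms-unique : ∀ {xs} → Unique xs → Unique (perms xs)
perms-unique {[]} _ = [] ∷ []
perms-unique {x ∷ xs} (x∉xs ∷ u) =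
  concatMap-unique (insertAll x) (perms-unique u)
    (λ i → insertAll-unique x _ (x∉ i))
    (λ i j p q → trans (sym (remove-insertAll x _ (x∉ i) p)) (remove-insertAll x _ (x∉ j) q))
  where
  x∉ : ∀ {ys} → ys ∈ perms xs → x ∉ ys
  x∉ i j = All.lookup x∉xs (∈-resp-↭ (∈-perms⇒↭ xs i) j) refl

range : ℕ → ℕ → List ℕ
range s zero = []
range s (suc n) = s ∷ range (suc s) n

applyUpTo-range : ∀ (f : ℕ → ℕ) s n → (∀ i → f i ≡ s + i) → applyUpTo f n ≡ range s n
applyUpTo-range f s zero _ = refl
applyUpTo-range f s (suc n) e =
  cong₂ _∷_ (trans (e 0) (+-identityʳ s))
            (applyUpTo-range (f ∘′ suc) (suc s) n λ i → trans (e (suc i)) (+-suc s i))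

oneTo≡range : ∀ n → oneTo n ≡ range 1 n
oneTo≡range n = trans (map-applyUpTo (λ i → i) suc n) (applyUpTo-range suc 1 n λ _ → refl)

∈-range⁻ : ∀ s n {x} → x ∈ range s n → s ≤ x × x < s + n
∈-range⁻ s (suc n) (here refl) = ≤-refl , m<m+n s z<s
∈-range⁻ s (suc n) {x} (there i) with s<x , x<s+n ← ∈-range⁻ (suc s) n i =
  <⇒≤ s<x , subst (x <_) (sym (+-suc s n)) x<s+n

∈-range⁺ : ∀ s n {x} → s ≤ x → x < s + n → x ∈ range s n
∈-range⁺ s zero s≤x x<s+0 = ⊥-elim (<⇒≱ x<s+0 (subst (_≤ _) (sym (+-identityʳ s)) s≤x))
∈-range⁺ s (suc n) {x} s≤x x<s+n with s ≟ x
... | yes refl = here refl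
... | no s≢x = there (∈-range⁺ (suc s) n (≤∧≢⇒< s≤x s≢x) (subst (x <_) (+-suc s n) x<s+n))

range-unique : ∀ s n → Unique (range s n)
range-unique s zero = []
range-unique s (suc n) =
  All.tabulate (λ i → <⇒≢ (proj₁ (∈-range⁻ (suc s) n i))) ∷ range-unique (suc s) n

data Tile : Set where
  square domino : Tile

Tiling : Set
Tiling = List Tile

size : Tiling → ℕ
size [] = 0
size (square ∷ t) = suc (size t)
size (domino ∷ t) = suc (suc (size t))

dominoes : Tiling → ℕ
dominoes [] = 0
dominoes (square ∷ t) = dominoes t
dominoes (domino ∷ t) = suc (dominoes t)

tilings : ℕ → List Tiling
tilings zero = [] ∷ []
tilings (suc zero) = (square ∷ []) ∷ []
tilings (suc (suc n)) = map (square ∷_) (tilings (suc n)) ++ map (domino ∷_) (tilings n)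

∈-tilings⁺ : ∀ M → M ∈ tilings (size M)
∈-tilings⁺ [] = here refl
∈-tilings⁺ (square ∷ []) = here refl
∈-tilings⁺ (square ∷ M@(square ∷ _)) = ∈-++⁺ˡ (∈-map⁺ (square ∷_) (∈-tilings⁺ M))
∈-tilings⁺ (square ∷ M@(domino ∷ _)) = ∈-++⁺ˡ (∈-map⁺ (square ∷_) (∈-tilings⁺ M))
∈-tilings⁺ (domino ∷ M) =
  ∈-++⁺ʳ (map (square ∷_) (tilings (suc (size M)))) (∈-map⁺ (domino ∷_) (∈-tilings⁺ M))

∈-tilings⁻ : ∀ n {M} → M ∈ tilings n → size M ≡ n
∈-tilings⁻ zero (here refl) = refl
∈-tilings⁻ (suc zero) (here refl) = refl
∈-tilings⁻ (suc (suc n)) i with ∈-++⁻ (map (square ∷_) (tilings (suc n))) i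
... | inj₁ j with _ , k , refl ← ∈-map⁻ (square ∷_) j = cong suc (∈-tilings⁻ (suc n) k)
... | inj₂ j with _ , k , refl ← ∈-map⁻ (domino ∷_) j = cong (suc ∘′ suc) (∈-tilings⁻ n k)

tilings-unique : ∀ n → Unique (tilings n)
tilings-unique zero = [] ∷ []
tilings-unique (suc zero) = [] ∷ []
tilings-unique (suc (suc n)) =
  ++⁺ (map⁺ ∷-injectiveʳ (tilings-unique (suc n))) (map⁺ ∷-injectiveʳ (tilings-unique n)) λ (i , j) →
    case ∈-map⁻ (square ∷_) i , ∈-map⁻ (domino ∷_) j of λ { ((_ , _ , refl) , (_ , _ , ())) }

size-++ : ∀ t u → size (t ++ u) ≡ size t + size u
size-++ [] u = refl
size-++ (square ∷ t) u = cong suc (size-++ t u)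
size-++ (domino ∷ t) u = cong (suc ∘′ suc) (size-++ t u)

dominoes-++ : ∀ t u → dominoes (t ++ u) ≡ dominoes t + dominoes u
dominoes-++ [] u = refl
dominoes-++ (square ∷ t) u = dominoes-++ t u
dominoes-++ (domino ∷ t) u = cong suc (dominoes-++ t u)

layered : Tiling → ℕ → List ℕ
layered [] s = []
layered (square ∷ t) s = s ∷ layered t (suc s)
layered (domino ∷ t) s = suc s ∷ s ∷ layered t (suc (suc s))

layered-↭ : ∀ t s → layered t s ↭ range s (size t)
layered-↭ [] s = ↭-refl
layered-↭ (square ∷ t) s = prep s (layered-↭ t (suc s))
layered-↭ (domino ∷ t) s = swap (suc s) s (layered-↭ t (suc (suc s)))

∈-layered⁻ : ∀ t s {x} → x ∈ layered t s → s ≤ x × x < s + size t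
∈-layered⁻ t s i = ∈-range⁻ s (size t) (∈-resp-↭ (layered-↭ t s) i)

layered-injective : ∀ {t t′} s → layered t s ≡ layered t′ s → t ≡ t′
layered-injective {[]} {[]} s e = refl
layered-injective {[]} {square ∷ _} s ()
layered-injective {[]} {domino ∷ _} s ()
layered-injective {square ∷ _} {[]} s ()
layered-injective {domino ∷ _} {[]} s ()
layered-injective {square ∷ t} {square ∷ t′} s e =
  cong (square ∷_) (layered-injective (suc s) (proj₂ (∷-injective e)))
layered-injective {domino ∷ t} {domino ∷ t′} s e =
  cong (domino ∷_) (layered-injective (suc (suc s)) (proj₂ (∷-injective (proj₂ (∷-injective e)))))
layered-injective {square ∷ t} {domino ∷ t′} s e = ⊥-elim (1+n≢n (sym (proj₁ (∷-injective e))))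
layered-injective {domino ∷ t} {square ∷ t′} s e = ⊥-elim (1+n≢n (proj₁ (∷-injective e)))

length-layered : ∀ t s → length (layered t s) ≡ size t
length-layered [] s = refl
length-layered (square ∷ t) s = cong suc (length-layered t (suc s))
length-layered (domino ∷ t) s = cong (suc ∘′ suc) (length-layered t (suc (suc s)))

layered-++ : ∀ t u s → layered (t ++ u) s ≡ layered t s ++ layered u (s + size t)
layered-++ [] u s rewrite +-identityʳ s = refl
layered-++ (square ∷ t) u s rewrite layered-++ t u (suc s) | +-suc s (size t) = refl
layered-++ (domino ∷ t) u s rewrite layered-++ t u (suc (suc s)) | +-suc s (suc (size t)) | +-suc s (size t) = refl

des-∷-layered : ∀ t {s x} → x ≤ s → des (x ∷ layered t s) ≡ dominoes t
des-∷-layered [] _ = refl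
des-∷-layered (square ∷ t) {s} x≤s rewrite <ᵇ-false x≤s = des-∷-layered t (n≤1+n s)
des-∷-layered (domino ∷ t) {s} x≤s rewrite <ᵇ-false (m≤n⇒m≤1+n x≤s) | <ᵇ-true (n<1+n s) =
  cong suc (des-∷-layered t (m≤n⇒m≤1+n (n≤1+n s)))

InversionsAdjacent : List ℕ → Set
InversionsAdjacent w = ∀ {x y} → x ∷ y ∷ [] ⊆ w → y < x → x ≡ suc y

layered-inversionsAdjacent : ∀ t s → InversionsAdjacent (layered t s)
layered-inversionsAdjacent (square ∷ t) s (_ ∷ʳ p) y<x = layered-inversionsAdjacent t (suc s) p y<x
layered-inversionsAdjacent (square ∷ t) s (refl ∷ p) y<x =
  ⊥-elim (<-asym y<x (proj₁ (∈-layered⁻ t (suc s) (to∈ p))))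
layered-inversionsAdjacent (domino ∷ t) s (_ ∷ʳ _ ∷ʳ p) y<x = layered-inversionsAdjacent t (suc (suc s)) p y<x
layered-inversionsAdjacent (domino ∷ t) s (_ ∷ʳ refl ∷ p) y<x =
  ⊥-elim (<-asym y<x (<-trans (n<1+n s) (proj₁ (∈-layered⁻ t (suc (suc s)) (to∈ p)))))
layered-inversionsAdjacent (domino ∷ t) s (refl ∷ _ ∷ʳ p) y<x =
  ⊥-elim (<-asym y<x (proj₁ (∈-layered⁻ t (suc (suc s)) (to∈ p))))
layered-inversionsAdjacent (domino ∷ t) s (refl ∷ refl ∷ _) y<x = refl

⊆⇒∈-subseqs : ∀ {xs ys} → xs ⊆ ys → xs ∈ subseqs (length xs) ys
⊆⇒∈-subseqs [] = here refl
⊆⇒∈-subseqs {[]} (_ ∷ʳ _) = here refl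
⊆⇒∈-subseqs {x ∷ xs} (y ∷ʳ p) = ∈-++⁺ʳ (map (y ∷_) (subseqs (length xs) _)) (⊆⇒∈-subseqs p)
⊆⇒∈-subseqs (refl ∷ p) = ∈-++⁺ˡ (∈-map⁺ _ (⊆⇒∈-subseqs p))

∈-subseqs⁻ : ∀ k ys {xs} → xs ∈ subseqs k ys → xs ⊆ ys × length xs ≡ k
∈-subseqs⁻ zero ys (here refl) = minimum ys , refl
∈-subseqs⁻ (suc k) (y ∷ ys) i with ∈-++⁻ (map (y ∷_) (subseqs k ys)) i
... | inj₁ j with _ , j′ , refl ← ∈-map⁻ (y ∷_) j =
  let p , l = ∈-subseqs⁻ k ys j′ in refl ∷ p , cong suc l
... | inj₂ j = let p , l = ∈-subseqs⁻ (suc k) ys j in y ∷ʳ p , l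

contains⁻ : ∀ w p → T (contains w p) → ∃ λ u → u ⊆ w × length u ≡ length p × T (orderIso u p)
contains⁻ w p h with u , i , iso ← find (any⁻ _ (subseqs (length p) w) h) =
  let u⊆w , l = ∈-subseqs⁻ (length p) w i in u , u⊆w , l , iso

contains⁺ : ∀ {u w} p → u ⊆ w → length u ≡ length p → T (orderIso u p) → T (contains w p)
contains⁺ {u} {w} p u⊆w l iso = any⁺ _ (lose (subst (λ k → u ∈ subseqs k w) l (⊆⇒∈-subseqs u⊆w)) iso)

Agree : ℕ → ℕ → ℕ → ℕ → Set
Agree x y p q = T (((x <ᵇ y) ⇔ᵇ (p <ᵇ q)) ∧ ((y <ᵇ x) ⇔ᵇ (q <ᵇ p)))

⇔ᵇ⇒≡ : ∀ a b → T (a ⇔ᵇ b) → a ≡ b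
⇔ᵇ⇒≡ true true _ = refl
⇔ᵇ⇒≡ false false _ = refl

agree-< : ∀ {x y p q} → p < q → Agree x y p q → x < y
agree-< {x} {y} {p} {q} p<q h with e ← ⇔ᵇ⇒≡ (x <ᵇ y) (p <ᵇ q) (proj₁ (∧-elim h)) =
  <ᵇ⇒< x y (subst T (sym (trans e (<ᵇ-true p<q))) tt)

agree-> : ∀ {x y p q} → q < p → Agree x y p q → y < x
agree-> {x} {y} {p} {q} q<p h with e ← ⇔ᵇ⇒≡ (y <ᵇ x) (q <ᵇ p) (proj₂ (∧-elim h)) =
  <ᵇ⇒< y x (subst T (sym (trans e (<ᵇ-true q<p))) tt)

<-agree : ∀ {x y p q} → x < y → p < q → Agree x y p q
<-agree x<y p<q rewrite <ᵇ-true x<y | <ᵇ-true p<q | <ᵇ-false (<⇒≤ x<y) | <ᵇ-false (<⇒≤ p<q) = tt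

>-agree : ∀ {x y p q} → y < x → q < p → Agree x y p q
>-agree y<x q<p rewrite <ᵇ-true y<x | <ᵇ-true q<p | <ᵇ-false (<⇒≤ y<x) | <ᵇ-false (<⇒≤ q<p) = tt

OrderIso₃ : (a b c p q r : ℕ) → Set
OrderIso₃ a b c p q r = Agree a b p q × Agree a c p r × Agree b c q r

orderIso₃⁻ : ∀ {a b c p q r} → T (orderIso (a ∷ b ∷ c ∷ []) (p ∷ q ∷ r ∷ [])) → OrderIso₃ a b c p q r
orderIso₃⁻ h = unpack h
  where
  unpack : ∀ {e₁ e₂ e₃} → T ((e₁ ∧ (e₂ ∧ true)) ∧ ((e₃ ∧ true) ∧ true)) → T e₁ × T e₂ × T e₃
  unpack {true} {true} {true} _ = tt , tt , tt

orderIso₃⁺ : ∀ {a b c p q r} → OrderIso₃ a b c p q r → T (orderIso (a ∷ b ∷ c ∷ []) (p ∷ q ∷ r ∷ []))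
orderIso₃⁺ h = pack h
  where
  pack : ∀ {e₁ e₂ e₃} → T e₁ × T e₂ × T e₃ → T ((e₁ ∧ (e₂ ∧ true)) ∧ ((e₃ ∧ true) ∧ true))
  pack {true} {true} {true} _ = tt

Contains₃ : List ℕ → (p q r : ℕ) → Set
Contains₃ w p q r = ∃₂ λ a b → ∃ λ c → a ∷ b ∷ c ∷ [] ⊆ w × OrderIso₃ a b c p q r

contains₃⁻ : ∀ w p q r → T (contains w (p ∷ q ∷ r ∷ [])) → Contains₃ w p q r
contains₃⁻ w p q r h with contains⁻ w (p ∷ q ∷ r ∷ []) h
... | a ∷ b ∷ c ∷ [] , u⊆w , _ , iso = a , b , c , u⊆w , orderIso₃⁻ {a} {b} {c} {p} {q} {r} iso
... | [] , _ , () , _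
... | _ ∷ [] , _ , () , _
... | _ ∷ _ ∷ [] , _ , () , _
... | _ ∷ _ ∷ _ ∷ _ ∷ _ , _ , () , _

contains₃⁺ : ∀ w p q r → Contains₃ w p q r → T (contains w (p ∷ q ∷ r ∷ []))
contains₃⁺ w p q r (a , b , c , u⊆w , iso) =
  contains⁺ (p ∷ q ∷ r ∷ []) u⊆w refl (orderIso₃⁺ {a} {b} {c} {p} {q} {r} iso)

Avoids231-312-321 : List ℕ → Set
Avoids231-312-321 w = ¬ Contains₃ w 2 3 1 × ¬ Contains₃ w 3 1 2 × ¬ Contains₃ w 3 2 1

avoidsAll⇒Avoids231-312-321 : ∀ w → T (avoidsAll P231-312-321 w) → Avoids231-312-321 w
avoidsAll⇒Avoids231-312-321 w h = let h₁ , h₂ , h₃ = unpack h in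
  (h₁ ∘′ contains₃⁺ w 2 3 1) , (h₂ ∘′ contains₃⁺ w 3 1 2) , (h₃ ∘′ contains₃⁺ w 3 2 1)
  where
  unpack : ∀ {c₁ c₂ c₃} → T (not c₁ ∧ (not c₂ ∧ (not c₃ ∧ true))) → ¬ T c₁ × ¬ T c₂ × ¬ T c₃
  unpack {false} {false} {false} _ = (λ ()) , (λ ()) , (λ ())

Avoids231-312-321⇒avoidsAll : ∀ w → Avoids231-312-321 w → T (avoidsAll P231-312-321 w)
Avoids231-312-321⇒avoidsAll w (a₁ , a₂ , a₃) =
  pack (a₁ ∘′ contains₃⁻ w 2 3 1) (a₂ ∘′ contains₃⁻ w 3 1 2) (a₃ ∘′ contains₃⁻ w 3 2 1)
  where
  pack : ∀ {c₁ c₂ c₃} → ¬ T c₁ → ¬ T c₂ → ¬ T c₃ → T (not c₁ ∧ (not c₂ ∧ (not c₃ ∧ true)))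
  pack {false} {false} {false} _ _ _ = tt
  pack {true} h _ _ = ⊥-elim (h tt)
  pack {false} {true} _ h _ = ⊥-elim (h tt)
  pack {false} {false} {true} _ _ h = ⊥-elim (h tt)

1<2 : 1 < 2
1<2 = ≤-refl
1<3 : 1 < 3
1<3 = m≤n⇒m≤1+n ≤-refl
2<3 : 2 < 3
2<3 = ≤-refl

inversionsAdjacent⇒avoids : ∀ {w} → InversionsAdjacent w → Avoids231-312-321 w
inversionsAdjacent⇒avoids {w} inv = no231 , no312 , no321
  where
  no231 : ¬ Contains₃ w 2 3 1
  no231 (a , b , c , u , a~b , a~c , b~c) with ab , ac , bc ← pairs-⊆ u =
    <-irrefl (trans (inv ac (agree-> 1<2 a~c)) (sym (inv bc (agree-> 1<3 b~c)))) (agree-< 2<3 a~b)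
  no312 : ¬ Contains₃ w 3 1 2
  no312 (a , b , c , u , a~b , a~c , b~c) with ab , ac , bc ← pairs-⊆ u =
    <-irrefl (suc-injective (trans (sym (inv ab (agree-> 1<3 a~b))) (inv ac (agree-> 2<3 a~c)))) (agree-< 1<2 b~c)
  no321 : ¬ Contains₃ w 3 2 1
  no321 (a , b , c , u , a~b , a~c , b~c) with ab , ac , bc ← pairs-⊆ u =
    <-irrefl (suc-injective (trans (sym (inv ac (agree-> 1<3 a~c))) (inv ab (agree-> 2<3 a~b)))) (agree-> 1<2 b~c)

layered-avoids : ∀ t s → Avoids231-312-321 (layered t s)
layered-avoids t s = inversionsAdjacent⇒avoids (layered-inversionsAdjacent t s)

avoids-tail : ∀ {a w} → Avoids231-312-321 (a ∷ w) → Avoids231-312-321 w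
avoids-tail {a} (n₁ , n₂ , n₃) =
  (λ (x , y , z , u , iso) → n₁ (x , y , z , a ∷ʳ u , iso)) ,
  (λ (x , y , z , u , iso) → n₂ (x , y , z , a ∷ʳ u , iso)) ,
  (λ (x , y , z , u , iso) → n₃ (x , y , z , a ∷ʳ u , iso))

module _ {s n : ℕ} where

  private
    bounds : ∀ {w x} → w ↭ range s (suc n) → x ∈ w → s ≤ x × x < s + suc n
    bounds p i = ∈-range⁻ s (suc n) (∈-resp-↭ p i)

    ∈⁺ : ∀ {w x} → w ↭ range s (suc n) → s ≤ x → x < s + suc n → x ∈ w
    ∈⁺ p s≤x x<s+n = ∈-resp-↭ (↭-sym p) (∈-range⁺ s (suc n) s≤x x<s+n)

  avoider-head : ∀ {a w} → a ∷ w ↭ range s (suc n) → Avoids231-312-321 (a ∷ w) → a ≡ s ⊎ a ≡ suc s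
  avoider-head {a} p (_ , no312 , no321) with a ≟ s
  ... | yes a≡s = inj₁ a≡s
  ... | no a≢s = inj₂ (≤-antisym a≤s+1 (≤∧≢⇒< (proj₁ (bounds p (here refl))) (a≢s ∘′ sym)))
    where
    -- if s + 1 < a, then s and s + 1 both follow a and form a 312 or a 321 with it
    a≤s+1 : a ≤ suc s
    a≤s+1 = ≮⇒≥ λ s+1<a →
      let s<a = <-trans (n<1+n s) s+1<a
          s∈w = Any.tail (<⇒≢ s<a) (∈⁺ p ≤-refl (<-≤-trans s<a (<⇒≤ (proj₂ (bounds p (here refl))))))
          s+1∈w = Any.tail (<⇒≢ s+1<a) (∈⁺ p (n≤1+n s) (<-trans s+1<a (proj₂ (bounds p (here refl)))))
      in case ∈⇒pair-⊆ s∈w s+1∈w (<⇒≢ (n<1+n s)) of λ where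
        (inj₁ u) → no312 (a , s , suc s , refl ∷ u , >-agree s<a 1<3 , >-agree s+1<a 2<3 , <-agree (n<1+n s) 1<2)
        (inj₂ u) → no321 (a , suc s , s , refl ∷ u , >-agree s+1<a 2<3 , >-agree s<a 1<3 , >-agree (n<1+n s) 1<2)

  avoider-after-successor : ∀ {b w} → suc s ∷ b ∷ w ↭ range s (suc n) →
    Avoids231-312-321 (suc s ∷ b ∷ w) → b ≡ s
  -- otherwise s + 1 < b and (s + 1, b, s) is a 231
  avoider-after-successor {b} {w} p (no231 , _ , _) with b ≟ s
  ... | yes b≡s = b≡s
  ... | no b≢s = ⊥-elim (no231 (suc s , b , s , refl ∷ refl ∷ from∈ s∈w ,
                                <-agree s+1<b 2<3 , >-agree (n<1+n s) 1<2 , >-agree s<b 1<3))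
    where
    s∈w : s ∈ w
    s∈w = Any.tail (b≢s ∘′ sym) (Any.tail (<⇒≢ (n<1+n s)) (∈-resp-↭ (↭-sym p) (here refl)))
    s<b : s < b
    s<b = ≤∧≢⇒< (proj₁ (bounds p (there (here refl)))) (b≢s ∘′ sym)
    s+1<b : suc s < b
    s+1<b with s+1∉ ∷ _ ← Unique-resp-↭ (range-unique s (suc n)) (↭-sym p) = ≤∧≢⇒< s<b (All.head s+1∉)

avoider⇒layered : ∀ s n w → w ↭ range s n → Avoids231-312-321 w → ∃ λ t → size t ≡ n × w ≡ layered t s
avoider⇒layered s zero w p _ rewrite ↭-empty-inv p = [] , refl , refl
avoider⇒layered s (suc n) [] p _ with () ← ↭-length p
avoider⇒layered s (suc n) (a ∷ w) p av with avoider-head p av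
... | inj₁ refl with t , refl , refl ← avoider⇒layered (suc s) n w (drop-∷ p) (avoids-tail av) =
  square ∷ t , refl , refl
... | inj₂ refl with w | n
...   | b ∷ w′ | suc n′ with refl ← avoider-after-successor p av
        with t , refl , refl ← avoider⇒layered (suc (suc s)) n′ w′
               (drop-∷ (drop-∷ (↭-trans (swap s (suc s) ↭-refl) p))) (avoids-tail (avoids-tail av)) =
  domino ∷ t , refl , refl
...   | _ ∷ _ | zero with () ← ↭-length p
...   | [] | _ with here s≡s+1 ← ∈-resp-↭ (↭-sym p) (here refl) = ⊥-elim (1+n≢n (sym s≡s+1))

diamondsOK-∷-++ : ∀ d c u L rest →
  diamondsOK (suc (suc (length u))) (suc d) (c ∷ u ++ L ∷ rest)
    ≡ blockRest c (u ++ L ∷ []) ∧ diamondsOK (suc (suc (length u))) d rest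
diamondsOK-∷-++ d c u L rest
  rewrite +-comm 1 (length u) | take-++-length u (L ∷ rest) 1 | drop-++-length u (L ∷ rest) 1 = refl

lastOf-++ : ∀ y ys L → lastOf y (ys ++ L ∷ []) ≡ L
lastOf-++ y [] L = refl
lastOf-++ y (z ∷ zs) L = lastOf-++ z zs L

blockRest-++⁺ : ∀ c u L → All (λ x → c < x × x < L) u → c < L → T (blockRest c (u ++ L ∷ []))
blockRest-++⁺ c [] L [] c<L = <⇒<ᵇ c<L
blockRest-++⁺ c (x ∷ []) L ((c<x , x<L) ∷ []) c<L = ∧-intro (<⇒<ᵇ c<x) (∧-intro (<⇒<ᵇ x<L) (<⇒<ᵇ c<L))
blockRest-++⁺ c (x ∷ y ∷ u) L ((c<x , x<L) ∷ bounds) c<L =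
  ∧-intro (<⇒<ᵇ c<x) (∧-intro (subst (λ z → T (x <ᵇ z)) (sym (lastOf-++ y u L)) (<⇒<ᵇ x<L))
                              (blockRest-++⁺ c (y ∷ u) L bounds c<L))

blockRest-++⁻ : ∀ c u L {x} → T (blockRest c (u ++ L ∷ [])) → x ∈ u → x < L
blockRest-++⁻ c (x ∷ []) L h (here refl) = <ᵇ⇒< x L (proj₁ (∧-elim (proj₂ (∧-elim {c <ᵇ x} h))))
blockRest-++⁻ c (x ∷ y ∷ u) L h (here refl) =
  <ᵇ⇒< x L (subst (λ z → T (x <ᵇ z)) (lastOf-++ y u L) (proj₁ (∧-elim (proj₂ (∧-elim {c <ᵇ x} h)))))
blockRest-++⁻ c (x ∷ y ∷ u) L h (there i) =
  blockRest-++⁻ c (y ∷ u) L (proj₂ (∧-elim {x <ᵇ lastOf y (u ++ L ∷ [])} (proj₂ (∧-elim {c <ᵇ x} h)))) i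

blockRest-head : ∀ c x rest → T (blockRest c (x ∷ rest)) → c < x
blockRest-head c x [] h = <ᵇ⇒< c x h
blockRest-head c x (_ ∷ _) h = <ᵇ⇒< c x (proj₁ (∧-elim h))

splitAt-size : ∀ k X → k ≤ size X →
  (∃₂ λ M Y → X ≡ M ++ Y × size M ≡ k) ⊎ (∃₂ λ M Y → X ≡ M ++ domino ∷ Y × suc (size M) ≡ k)
splitAt-size zero X _ = inj₁ ([] , X , refl , refl)
splitAt-size (suc k) (square ∷ X) (s≤s k≤X) with splitAt-size k X k≤X
... | inj₁ (M , Y , refl , e) = inj₁ (square ∷ M , Y , refl , cong suc e)
... | inj₂ (M , Y , refl , e) = inj₂ (square ∷ M , Y , refl , cong suc e)
splitAt-size (suc zero) (domino ∷ X) _ = inj₂ ([] , X , refl , refl)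
splitAt-size (suc (suc k)) (domino ∷ X) (s≤s (s≤s k≤X)) with splitAt-size k X k≤X
... | inj₁ (M , Y , refl , e) = inj₁ (domino ∷ M , Y , refl , cong (suc ∘′ suc) e)
... | inj₂ (M , Y , refl , e) = inj₂ (domino ∷ M , Y , refl , cong (suc ∘′ suc) e)

++-size-injective : ∀ M M′ {A A′} → size M ≡ size M′ → M ++ A ≡ M′ ++ A′ → M ≡ M′ × A ≡ A′
++-size-injective [] [] _ eq = refl , eq
++-size-injective (square ∷ M) (square ∷ M′) s eq
  with refl , eq′ ← ++-size-injective M M′ (suc-injective s) (∷-injectiveʳ eq) = refl , eq′
++-size-injective (domino ∷ M) (domino ∷ M′) s eq
  with refl , eq′ ← ++-size-injective M M′ (suc-injective (suc-injective s)) (∷-injectiveʳ eq) = refl , eq′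
++-size-injective (square ∷ _) (domino ∷ _) _ ()
++-size-injective (domino ∷ _) (square ∷ _) _ ()
++-size-injective [] (square ∷ _) () _
++-size-injective [] (domino ∷ _) () _
++-size-injective (square ∷ _) [] () _
++-size-injective (domino ∷ _) [] () _

module Diamonds (m : ℕ) where

  V : ℕ
  V = suc (suc m)

  separator : Bool → Tiling
  separator false = square ∷ square ∷ []
  separator true = domino ∷ []

  -- Tiling of a reading word after its first letter (the least element of the first diamond):
  -- middle Mᵢ tiles the middle elements of diamond i; between two middles, the greatest element of
  -- one diamond and the least of the next form two squares, or a domino if they are inverted;
  -- the final square is the greatest element of the last diamond.
  assemble : ∀ {d} → Vec Bool d → Vec Tiling (suc d) → Tiling
  assemble [] (M ∷ []) = M ++ square ∷ []
  assemble (b ∷ bs) (M ∷ Ms) = M ++ separator b ++ assemble bs Ms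

  Middles : ∀ {n} → Vec Tiling n → Set
  Middles = VecAll.All (λ M → size M ≡ m)

  layered-middle : ∀ M u b → size M ≡ m → layered (M ++ u) b ≡ layered M b ++ layered u (b + m)
  layered-middle M u b e = trans (layered-++ M u b) (cong (λ k → layered M b ++ layered u (b + k)) e)

  middle-blockRest : ∀ M {b c L} → size M ≡ m → c < b → b + m ≤ L → T (blockRest c (layered M b ++ L ∷ []))
  middle-blockRest M {b} e c<b b+m≤L = blockRest-++⁺ _ (layered M b) _
    (All.tabulate λ i → let b≤x , x<b+M = ∈-layered⁻ M b i
                        in <-≤-trans c<b b≤x , <-≤-trans x<b+M (subst (λ k → b + k ≤ _) (sym e) b+m≤L))
    (<-≤-trans c<b (≤-trans (m≤m+n b m) b+m≤L))

  diamondsOK-block : ∀ d c u L rest → length u ≡ m →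
    diamondsOK V (suc d) (c ∷ u ++ L ∷ rest) ≡ blockRest c (u ++ L ∷ []) ∧ diamondsOK V d rest
  diamondsOK-block d c u L rest e =
    subst (λ k → diamondsOK (suc (suc k)) (suc d) (c ∷ u ++ L ∷ rest)
                 ≡ blockRest c (u ++ L ∷ []) ∧ diamondsOK (suc (suc k)) d rest)
          e (diamondsOK-∷-++ d c u L rest)

  diamondsOK-block⁺ : ∀ d {c} u {L rest} → length u ≡ m →
    T (blockRest c (u ++ L ∷ [])) → T (diamondsOK V d rest) → T (diamondsOK V (suc d) (c ∷ u ++ L ∷ rest))
  diamondsOK-block⁺ d {c} u {L} {rest} e h₁ h₂ =
    subst T (sym (diamondsOK-block d c u L rest e)) (∧-intro h₁ h₂)

  diamondsOK-block⁻ : ∀ d {c} u {L rest} → length u ≡ m → T (diamondsOK V (suc d) (c ∷ u ++ L ∷ rest)) →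
    T (blockRest c (u ++ L ∷ [])) × T (diamondsOK V d rest)
  diamondsOK-block⁻ d {c} u {L} {rest} e h = ∧-elim (subst T (diamondsOK-block d c u L rest e) h)

  length-middle : ∀ M b → size M ≡ m → length (layered M b) ≡ m
  length-middle M b e = trans (length-layered M b) e

  middle-diamondsOK⁺ : ∀ d {c} M {b L rest} → size M ≡ m → c < b → b + m ≤ L → T (diamondsOK V d rest) →
    T (diamondsOK V (suc d) (c ∷ layered M b ++ L ∷ rest))
  middle-diamondsOK⁺ d M {b} e c<b b+m≤L =
    diamondsOK-block⁺ d (layered M b) (length-middle M b e) (middle-blockRest M e c<b b+m≤L)

  middle-diamondsOK⁻ : ∀ d {c} M {b L rest} → size M ≡ m → T (diamondsOK V (suc d) (c ∷ layered M b ++ L ∷ rest)) →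
    T (diamondsOK V d rest)
  middle-diamondsOK⁻ d M {b} e h = proj₂ (diamondsOK-block⁻ d (layered M b) (length-middle M b e) h)

  assemble-diamondsOK : ∀ {d} (bs : Vec Bool d) Ms → Middles Ms → ∀ {c b} → c < b →
    T (diamondsOK V (suc d) (c ∷ layered (assemble bs Ms) b))
  assemble-diamondsOK [] (M ∷ []) (e ∷ []) {b = b} c<b rewrite layered-middle M (square ∷ []) b e =
    middle-diamondsOK⁺ 0 M e c<b ≤-refl tt
  assemble-diamondsOK {suc d} (false ∷ bs) (M ∷ Ms) (e ∷ es) {b = b} c<b
    rewrite layered-middle M (separator false ++ assemble bs Ms) b e =
    middle-diamondsOK⁺ (suc d) M e c<b ≤-refl (assemble-diamondsOK bs Ms es (n<1+n _))
  assemble-diamondsOK {suc d} (true ∷ bs) (M ∷ Ms) (e ∷ es) {b = b} c<b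
    rewrite layered-middle M (separator true ++ assemble bs Ms) b e =
    middle-diamondsOK⁺ (suc d) M e c<b (n≤1+n _) (assemble-diamondsOK bs Ms es (<-trans (n<1+n _) (n<1+n _)))

  size-separator : ∀ b X → size (separator b ++ X) ≡ suc (suc (size X))
  size-separator false X = refl
  size-separator true X = refl

  size-assemble : ∀ {d} (bs : Vec Bool d) Ms → Middles Ms → size (assemble bs Ms) ≡ suc m + d * V
  size-assemble [] (M ∷ []) (e ∷ []) rewrite size-++ M (square ∷ []) | e | +-identityʳ m = +-comm m 1
  size-assemble {suc d} (b ∷ bs) (M ∷ Ms) (e ∷ es) = begin
    size (M ++ separator b ++ assemble bs Ms)              ≡⟨ size-++ M _ ⟩
    size M + size (separator b ++ assemble bs Ms)          ≡⟨ cong₂ _+_ e (size-separator b _) ⟩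
    m + suc (suc (size (assemble bs Ms)))                  ≡⟨ cong (λ k → m + suc (suc k)) (size-assemble bs Ms es) ⟩
    m + suc (suc (suc m + d * V))                          ≡⟨ size-step m (d * V) ⟩
    suc m + suc d * V                                      ∎
    where
    open ≡-Reasoning
    size-step : ∀ m k → m + suc (suc (suc m + k)) ≡ suc m + (suc (suc m) + k)
    size-step = solve-∀

  no-descent : ∀ d {x y} rest → y < x → ¬ T (diamondsOK V (suc d) (x ∷ y ∷ rest))
  no-descent d {x} {y} rest y<x h = <-asym y<x (blockRest-head x y (take m rest) (proj₁ (∧-elim h)))

  -- the larger value of the domino would be a middle element above the diamond's greatest element
  no-straddle : ∀ d {c b} M Y → suc (size M) ≡ m → ¬ T (diamondsOK V (suc d) (c ∷ layered (M ++ domino ∷ Y) b))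
  no-straddle d {c} {b} M Y e h =
    1+n≰n (<⇒≤ (blockRest-++⁻ c u k (proj₁ (diamondsOK-block⁻ d u length-u h′))
                              (∈-++⁺ʳ (layered M b) (here refl))))
    where
    k = b + size M
    u = layered M b ++ suc k ∷ []
    length-u : length u ≡ m
    length-u rewrite length-++ (layered M b) {suc k ∷ []} | length-layered M b | +-comm (size M) 1 = e
    h′ : T (diamondsOK V (suc d) (c ∷ u ++ k ∷ layered Y (suc (suc k))))
    h′ = subst (λ w → T (diamondsOK V (suc d) (c ∷ w)))
               (trans (layered-++ M (domino ∷ Y) b) (sym (++-assoc (layered M b) (suc k ∷ []) _))) h

  Assembled : ∀ d → Tiling → Set
  Assembled d X = ∃₂ λ (bs : Vec Bool d) Ms → Middles Ms × X ≡ assemble bs Ms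

  diamondsOK⇒assembled : ∀ d X {c b} → size X ≡ suc m + d * V →
    T (diamondsOK V (suc d) (c ∷ layered X b)) → Assembled d X

  middle-diamondsOK⇒assembled : ∀ d M Y {c b} → size M ≡ m → size Y ≡ suc (d * V) →
    T (diamondsOK V (suc d) (c ∷ layered M b ++ layered Y (b + m))) → Assembled d (M ++ Y)
  middle-diamondsOK⇒assembled zero M (square ∷ []) e _ _ = [] , M ∷ [] , e ∷ [] , refl
  middle-diamondsOK⇒assembled (suc d) M (domino ∷ Y) e sY h
    with bs , Ms , es , refl ← diamondsOK⇒assembled d Y (suc-injective (suc-injective sY))
                                 (middle-diamondsOK⁻ (suc d) M e h) =
    true ∷ bs , M ∷ Ms , e ∷ es , refl
  middle-diamondsOK⇒assembled (suc d) M (square ∷ square ∷ Y) e sY h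
    with bs , Ms , es , refl ← diamondsOK⇒assembled d Y (suc-injective (suc-injective sY))
                                 (middle-diamondsOK⁻ (suc d) M e h) =
    false ∷ bs , M ∷ Ms , e ∷ es , refl
  middle-diamondsOK⇒assembled (suc d) M (square ∷ domino ∷ Y) e sY h =
    ⊥-elim (no-descent d _ (n<1+n _) (middle-diamondsOK⁻ (suc d) M e h))
  middle-diamondsOK⇒assembled zero M [] e () h
  middle-diamondsOK⇒assembled zero M (square ∷ square ∷ _) e () h
  middle-diamondsOK⇒assembled zero M (square ∷ domino ∷ _) e () h
  middle-diamondsOK⇒assembled zero M (domino ∷ _) e () h
  middle-diamondsOK⇒assembled (suc d) M [] e () h
  middle-diamondsOK⇒assembled (suc d) M (square ∷ []) e () h

  diamondsOK⇒assembled d X {c} {b} sX h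
    with splitAt-size m X (≤-trans (n≤1+n m) (subst (suc m ≤_) (sym sX) (m≤m+n (suc m) _)))
  ... | inj₂ (M , Y , refl , e) = ⊥-elim (no-straddle d M Y e h)
  ... | inj₁ (M , Y , refl , e) =
    middle-diamondsOK⇒assembled d M Y e sY (subst (λ w → T (diamondsOK V (suc d) (c ∷ w))) (layered-middle M Y b e) h)
    where
    sY : size Y ≡ suc (d * V)
    sY = +-cancelˡ-≡ m _ _ (trans (cong (_+ size Y) (sym e)) (trans (sym (size-++ M Y)) (trans sX (sym (+-suc m _)))))

  diamondWord⇒assembled : ∀ d t → size t ≡ suc d * V → T (diamondsOK V (suc d) (layered t 1)) →
    ∃₂ λ (bs : Vec Bool d) Ms → Middles Ms × t ≡ square ∷ assemble bs Ms
  diamondWord⇒assembled d (square ∷ X) st h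
    with bs , Ms , es , refl ← diamondsOK⇒assembled d X (suc-injective st) h = bs , Ms , es , refl
  diamondWord⇒assembled d (domino ∷ X) _ h = ⊥-elim (no-descent d _ (n<1+n 1) h)
  diamondWord⇒assembled d [] () _

  assembled⇒diamondWord : ∀ {d} (bs : Vec Bool d) Ms → Middles Ms →
    T (diamondsOK V (suc d) (layered (square ∷ assemble bs Ms) 1))
  assembled⇒diamondWord bs Ms es = assemble-diamondsOK bs Ms es (n<1+n 1)

  separator-injective : ∀ b b′ R R′ → separator b ++ R ≡ separator b′ ++ R′ → b ≡ b′ × R ≡ R′
  separator-injective false false R R′ refl = refl , refl
  separator-injective true true R R′ refl = refl , refl
  separator-injective false true R R′ ()
  separator-injective true false R R′ ()

  assemble-injective : ∀ {d} {bs bs′ : Vec Bool d} {Ms Ms′} → Middles Ms → Middles Ms′ →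
    assemble bs Ms ≡ assemble bs′ Ms′ → bs ≡ bs′ × Ms ≡ Ms′
  assemble-injective {bs = []} {[]} {M ∷ []} {M′ ∷ []} (e ∷ []) (e′ ∷ []) eq
    with refl , _ ← ++-size-injective M M′ (trans e (sym e′)) eq = refl , refl
  assemble-injective {bs = b ∷ bs} {b′ ∷ bs′} {M ∷ Ms} {M′ ∷ Ms′} (e ∷ es) (e′ ∷ es′) eq
    with refl , eq₁ ← ++-size-injective M M′ (trans e (sym e′)) eq
    with refl , eq₂ ← separator-injective b b′ _ _ eq₁
    with refl , refl ← assemble-injective {bs = bs} {bs′} es es′ eq₂ = refl , refl

  separatorWeight : ∀ {d} → Vec Bool d → ℕ
  separatorWeight bs = Vec.sum (Vec.map (dominoes ∘′ separator) bs)

  middleWeight : ∀ {d} → Vec Tiling d → ℕ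
  middleWeight Ms = Vec.sum (Vec.map dominoes Ms)

  dominoes-assemble : ∀ {d} (bs : Vec Bool d) Ms → dominoes (assemble bs Ms) ≡ separatorWeight bs + middleWeight Ms
  dominoes-assemble [] (M ∷ []) = dominoes-++ M (square ∷ [])
  dominoes-assemble (b ∷ bs) (M ∷ Ms) = begin
    dominoes (M ++ separator b ++ assemble bs Ms)                        ≡⟨ dominoes-++ M _ ⟩
    dominoes M + dominoes (separator b ++ assemble bs Ms)                ≡⟨ cong (dominoes M +_) (dominoes-++ (separator b) _) ⟩
    dominoes M + (dominoes (separator b) + dominoes (assemble bs Ms))    ≡⟨ cong (λ k → dominoes M + (dominoes (separator b) + k))
                                                                                 (dominoes-assemble bs Ms) ⟩
    dominoes M + (dominoes (separator b) + (separatorWeight bs + middleWeight Ms))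
      ≡⟨ rearrange (dominoes M) (dominoes (separator b)) (separatorWeight bs) (middleWeight Ms) ⟩
    dominoes (separator b) + separatorWeight bs + (dominoes M + middleWeight Ms) ∎
    where
    open ≡-Reasoning
    rearrange : ∀ x y z u → x + (y + (z + u)) ≡ y + z + (x + u)
    rearrange = solve-∀

boolToℕ : Bool → ℕ
boolToℕ true = 1
boolToℕ false = 0

monomial : ℕ → Poly
monomial k i = boolToℕ (k ≡ᵇ i)

module _ {A : Set} where

  countᵇ : (A → Bool) → List A → ℕ
  countᵇ p L = length (filter (λ a → T? (p a)) L)

  weightCount : (A → ℕ) → List A → Poly
  weightCount w L n = countᵇ (λ a → w a ≡ᵇ n) L

  countᵇ-∷ : ∀ p a L → countᵇ p (a ∷ L) ≡ boolToℕ (p a) + countᵇ p L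
  countᵇ-∷ p a L with p a
  ... | true = refl
  ... | false = refl

  countᵇ-cong : ∀ {p q} L → (∀ {a} → a ∈ L → p a ≡ q a) → countᵇ p L ≡ countᵇ q L
  countᵇ-cong [] _ = refl
  countᵇ-cong {p} {q} (a ∷ L) p≗q = begin
    countᵇ p (a ∷ L)               ≡⟨ countᵇ-∷ p a L ⟩
    boolToℕ (p a) + countᵇ p L     ≡⟨ cong₂ (λ b k → boolToℕ b + k) (p≗q (here refl))
                                             (countᵇ-cong L (p≗q ∘′ there)) ⟩
    boolToℕ (q a) + countᵇ q L     ≡⟨ countᵇ-∷ q a L ⟨
    countᵇ q (a ∷ L)               ∎
    where
    open ≡-Reasoning

  countᵇ-false : ∀ L → countᵇ (λ _ → false) L ≡ 0
  countᵇ-false [] = refl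
  countᵇ-false (_ ∷ L) = countᵇ-false L

  countᵇ-++ : ∀ p L L′ → countᵇ p (L ++ L′) ≡ countᵇ p L + countᵇ p L′
  countᵇ-++ p L L′ = trans (cong length (filter-++ _ L L′)) (length-++ (filter _ L))

  countᵇ-↭ : ∀ p {L L′} → L ↭ L′ → countᵇ p L ≡ countᵇ p L′
  countᵇ-↭ p L↭L′ = ↭-length (filter-↭ _ L↭L′)

countᵇ-map : ∀ {A B : Set} (p : B → Bool) (f : A → B) L → countᵇ p (map f L) ≡ countᵇ (λ a → p (f a)) L
countᵇ-map p f [] = refl
countᵇ-map p f (a ∷ L) with p (f a)
... | true = cong suc (countᵇ-map p f L)
... | false = countᵇ-map p f L

≡ᵇ-shift : ∀ k n x → (k + x ≡ᵇ n) ≡ (if k <ᵇ suc n then x ≡ᵇ n ∸ k else false)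
≡ᵇ-shift zero n x = refl
≡ᵇ-shift (suc k) zero x = refl
≡ᵇ-shift (suc k) (suc n) x = ≡ᵇ-shift k n x

weightCount-shift : ∀ {A : Set} (w : A → ℕ) k L n →
  weightCount (λ a → k + w a) L n ≡ (if k <ᵇ suc n then weightCount w L (n ∸ k) else 0)
weightCount-shift w k L n = trans (countᵇ-cong L λ {a} _ → ≡ᵇ-shift k n (w a)) (countᵇ-if (k <ᵇ suc n))
  where
  countᵇ-if : ∀ c → countᵇ (λ a → if c then w a ≡ᵇ n ∸ k else false) L ≡ (if c then weightCount w L (n ∸ k) else 0)
  countᵇ-if true = refl
  countᵇ-if false = countᵇ-false L

sum-map-zero : ∀ (l : List ℕ) → sum (map (λ _ → 0) l) ≡ 0
sum-map-zero [] = refl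
sum-map-zero (_ ∷ l) = sum-map-zero l

sum-map-+ : ∀ (f g : ℕ → ℕ) l → sum (map (λ i → f i + g i) l) ≡ sum (map f l) + sum (map g l)
sum-map-+ f g [] = refl
sum-map-+ f g (x ∷ l) = trans (cong (f x + g x +_) (sum-map-+ f g l)) (+-+-comm (f x) (g x) _ _)
  where
  +-+-comm : ∀ a b c d → a + b + (c + d) ≡ a + c + (b + d)
  +-+-comm = solve-∀

sum-monomial : ∀ k (g : ℕ → ℕ) N → sum (map (λ i → monomial k i * g i) (upTo N)) ≡ (if k <ᵇ N then g k else 0)
sum-monomial k g zero = refl
sum-monomial k g (suc N) = begin
  sum (map F (upTo (suc N)))           ≡⟨ cong (sum ∘′ map F) (upTo-∷ʳ N) ⟨
  sum (map F (upTo N ++ N ∷ []))       ≡⟨ cong sum (map-++ F (upTo N) (N ∷ [])) ⟩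
  sum (map F (upTo N) ++ F N ∷ [])     ≡⟨ sum-++ (map F (upTo N)) (F N ∷ []) ⟩
  sum (map F (upTo N)) + (F N + 0)     ≡⟨ cong₂ _+_ (sum-monomial k g N) (+-identityʳ (F N)) ⟩
  (if k <ᵇ N then g k else 0) + F N    ≡⟨ last-term ⟩
  (if k <ᵇ suc N then g k else 0)      ∎
  where
  open ≡-Reasoning
  F : ℕ → ℕ
  F i = monomial k i * g i
  last-term : (if k <ᵇ N then g k else 0) + F N ≡ (if k <ᵇ suc N then g k else 0)
  last-term with <-cmp k N
  ... | tri< k<N k≢N _ rewrite <ᵇ-true k<N | <ᵇ-true (m<n⇒m<1+n k<N) | ≡ᵇ-false k≢N = +-identityʳ (g k)
  ... | tri≈ _ refl _ rewrite <ᵇ-false (≤-refl {k}) | ≡ᵇ-refl k | <ᵇ-true (n<1+n k) = +-identityʳ (g k)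
  ... | tri> _ k≢N N<k rewrite <ᵇ-false (<⇒≤ N<k) | <ᵇ-false N<k | ≡ᵇ-false k≢N = refl

polyMul-cong : ∀ {p p′ q q′} → (∀ i → p i ≡ p′ i) → (∀ i → q i ≡ q′ i) →
  ∀ n → polyMul p q n ≡ polyMul p′ q′ n
polyMul-cong p≗p′ q≗q′ n = cong sum (map-cong (λ i → cong₂ _*_ (p≗p′ i) (q≗q′ (n ∸ i))) (upTo (suc n)))

polyPow-cong : ∀ {p p′} → (∀ i → p i ≡ p′ i) → ∀ k n → polyPow p k n ≡ polyPow p′ k n
polyPow-cong p≗p′ zero n = refl
polyPow-cong p≗p′ (suc k) n = polyMul-cong p≗p′ (polyPow-cong p≗p′ k) n

polyMul-+ˡ : ∀ p p′ q n → polyMul (λ i → p i + p′ i) q n ≡ polyMul p q n + polyMul p′ q n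
polyMul-+ˡ p p′ q n = trans (cong sum (map-cong (λ i → *-distribʳ-+ (q (n ∸ i)) (p i) (p′ i)) (upTo (suc n))))
                            (sum-map-+ (λ i → p i * q (n ∸ i)) (λ i → p′ i * q (n ∸ i)) (upTo (suc n)))

polyMul-monomial : ∀ k q n → polyMul (monomial k) q n ≡ (if k <ᵇ suc n then q (n ∸ k) else 0)
polyMul-monomial k q n = sum-monomial k (λ i → q (n ∸ i)) (suc n)

polyMul-zeroˡ : ∀ q n → polyMul (λ _ → 0) q n ≡ 0
polyMul-zeroˡ q n = sum-map-zero (upTo (suc n))

module _ {A B : Set} (w₁ : A → ℕ) (w₂ : B → ℕ) where

  weightCount-cartesianProduct : ∀ L₁ L₂ n →
    weightCount (λ (a , b) → w₁ a + w₂ b) (cartesianProduct L₁ L₂) n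
      ≡ polyMul (weightCount w₁ L₁) (weightCount w₂ L₂) n
  weightCount-cartesianProduct [] L₂ n = sym (polyMul-zeroˡ (weightCount w₂ L₂) n)
  weightCount-cartesianProduct (a ∷ L₁) L₂ n = begin
    weightCount w (map (a ,_) L₂ ++ cartesianProduct L₁ L₂) n
      ≡⟨ countᵇ-++ _ (map (a ,_) L₂) _ ⟩
    weightCount w (map (a ,_) L₂) n + weightCount w (cartesianProduct L₁ L₂) n
      ≡⟨ cong₂ _+_ (trans (countᵇ-map _ (a ,_) L₂) (weightCount-shift w₂ (w₁ a) L₂ n))
                   (weightCount-cartesianProduct L₁ L₂ n) ⟩
    (if w₁ a <ᵇ suc n then q (n ∸ w₁ a) else 0) + polyMul (weightCount w₁ L₁) q n
      ≡⟨ cong (_+ polyMul (weightCount w₁ L₁) q n) (polyMul-monomial (w₁ a) q n) ⟨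
    polyMul (monomial (w₁ a)) q n + polyMul (weightCount w₁ L₁) q n
      ≡⟨ polyMul-+ˡ (monomial (w₁ a)) (weightCount w₁ L₁) q n ⟨
    polyMul (λ i → monomial (w₁ a) i + weightCount w₁ L₁ i) q n
      ≡⟨ polyMul-cong {q = q} {q′ = q} (λ i → sym (countᵇ-∷ (λ x → w₁ x ≡ᵇ i) a L₁)) (λ _ → refl) n ⟩
    polyMul (weightCount w₁ (a ∷ L₁)) q n ∎
    where
    open ≡-Reasoning
    w : A × B → ℕ
    w (a , b) = w₁ a + w₂ b
    q : Poly
    q = weightCount w₂ L₂

module _ {A : Set} where

  vectors : List A → ∀ k → List (Vec A k)
  vectors L zero = [] ∷ []
  vectors L (suc k) = map (uncurry _∷_) (cartesianProduct L (vectors L k))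

  ∈-vectors⁺ : ∀ {L k} {xs : Vec A k} → VecAll.All (_∈ L) xs → xs ∈ vectors L k
  ∈-vectors⁺ [] = here refl
  ∈-vectors⁺ (x∈L ∷ xs∈L) = ∈-map⁺ (uncurry _∷_) (∈-cartesianProduct⁺ x∈L (∈-vectors⁺ xs∈L))

  ∈-vectors⁻ : ∀ {L} k {xs : Vec A k} → xs ∈ vectors L k → VecAll.All (_∈ L) xs
  ∈-vectors⁻ zero {[]} _ = []
  ∈-vectors⁻ {L} (suc k) i with (x , xs) , j , refl ← ∈-map⁻ (uncurry _∷_) i
    with x∈L , xs∈ ← ∈-cartesianProduct⁻ L (vectors L k) j = x∈L ∷ ∈-vectors⁻ k xs∈

  vectors-unique : ∀ {L} → Unique L → ∀ k → Unique (vectors L k)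
  vectors-unique u zero = [] ∷ []
  vectors-unique u (suc k) =
    map⁺ (λ { {_ , _} {_ , _} e → uncurry (cong₂ _,_) (Vec.∷-injective e) }) (cartesianProduct⁺ u (vectors-unique u k))

  weightCount-vectors : ∀ (w : A → ℕ) L k n →
    weightCount (λ xs → Vec.sum (Vec.map w xs)) (vectors L k) n ≡ polyPow (weightCount w L) k n
  weightCount-vectors w L zero zero = refl
  weightCount-vectors w L zero (suc n) = refl
  weightCount-vectors w L (suc k) n = begin
    weightCount W (map (uncurry _∷_) (cartesianProduct L (vectors L k))) n
      ≡⟨ countᵇ-map (λ xs → W xs ≡ᵇ n) (uncurry _∷_) (cartesianProduct L (vectors L k)) ⟩
    weightCount (λ (x , xs) → w x + W xs) (cartesianProduct L (vectors L k)) n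
      ≡⟨ weightCount-cartesianProduct w W L (vectors L k) n ⟩
    polyMul (weightCount w L) (weightCount W (vectors L k)) n
      ≡⟨ polyMul-cong {p = weightCount w L} (λ _ → refl) (weightCount-vectors w L k) n ⟩
    polyPow (weightCount w L) (suc k) n ∎
    where
    open ≡-Reasoning
    W : ∀ {k} → Vec A k → ℕ
    W xs = Vec.sum (Vec.map w xs)

weightCount-tilings : ∀ n k → weightCount dominoes (tilings n) k ≡ (n ∸ k) C k
weightCount-tilings zero zero = refl
weightCount-tilings zero (suc k) = refl
weightCount-tilings (suc zero) zero = refl
weightCount-tilings (suc zero) (suc zero) = refl
weightCount-tilings (suc zero) (suc (suc k)) = refl
weightCount-tilings (suc (suc n)) k = begin
  weightCount dominoes (map (square ∷_) (tilings (suc n)) ++ map (domino ∷_) (tilings n)) k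
    ≡⟨ countᵇ-++ _ (map (square ∷_) (tilings (suc n))) _ ⟩
  weightCount dominoes (map (square ∷_) (tilings (suc n))) k + weightCount dominoes (map (domino ∷_) (tilings n)) k
    ≡⟨ cong₂ _+_ (trans (countᵇ-map _ (square ∷_) (tilings (suc n))) (weightCount-tilings (suc n) k))
                 (trans (countᵇ-map _ (domino ∷_) (tilings n)) (weightCount-shift dominoes 1 (tilings n) k)) ⟩
  (suc n ∸ k) C k + (if 1 <ᵇ suc k then weightCount dominoes (tilings n) (k ∸ 1) else 0)
    ≡⟨ pascal k ⟩
  (suc (suc n) ∸ k) C k ∎
  where
  open ≡-Reasoning
  pascal : ∀ k → (suc n ∸ k) C k + (if 1 <ᵇ suc k then weightCount dominoes (tilings n) (k ∸ 1) else 0)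
                ≡ (suc (suc n) ∸ k) C k
  pascal zero = refl
  pascal (suc k) with ≤-<-connex k n
  ... | inj₁ k≤n = begin
    (n ∸ k) C suc k + weightCount dominoes (tilings n) k   ≡⟨ cong ((n ∸ k) C suc k +_) (weightCount-tilings n k) ⟩
    (n ∸ k) C suc k + (n ∸ k) C k                          ≡⟨ +-comm ((n ∸ k) C suc k) _ ⟩
    (n ∸ k) C k + (n ∸ k) C suc k                          ≡⟨ nCk+nC[k+1]≡[n+1]C[k+1] (n ∸ k) k ⟩
    suc (n ∸ k) C suc k                                    ≡⟨ cong (_C suc k) (+-∸-assoc 1 k≤n) ⟨
    (suc n ∸ k) C suc k                                    ∎
  ... | inj₂ n<k rewrite m≤n⇒m∸n≡0 (<⇒≤ n<k) | m≤n⇒m∸n≡0 n<k | weightCount-tilings n k | m≤n⇒m∸n≡0 (<⇒≤ n<k)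
    with suc _ ← k = refl

weightCount-tilings≡fibPoly : ∀ m k → weightCount dominoes (tilings m) k ≡ fibPoly (suc (suc m)) k
weightCount-tilings≡fibPoly m k with m / 2 <ᵇ k in eq
... | false = weightCount-tilings m k
... | true = trans (weightCount-tilings m k) (k>n⇒nCk≡0 (≰⇒> k≰m∸k))
  where
  k≰m∸k : ¬ (k ≤ m ∸ k)
  k≰m∸k k≤m∸k = <⇒≱ (<ᵇ⇒< (m / 2) k (subst T (sym eq) _))
    (subst (_≤ m / 2) (m*n/n≡m k 2) (/-monoˡ-≤ 2 (subst (_≤ m) (*-comm 2 k) 2k≤m)))
    where
    2k≤m : 2 * k ≤ m
    2k≤m = subst (_≤ m) (cong (k +_) (sym (+-identityʳ k)))
             (subst (k + k ≤_) (m+[n∸m]≡n (≤-trans k≤m∸k (m∸n≤m m k))) (+-monoʳ-≤ k k≤m∸k))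

bools : List Bool
bools = false ∷ true ∷ []

∈-bools : ∀ b → b ∈ bools
∈-bools false = here refl
∈-bools true = there (here refl)

bools-unique : Unique bools
bools-unique = ((λ ()) ∷ []) ∷ [] ∷ []

module Enumeration (m : ℕ) where
  open Diamonds m public

  configurations : ∀ d → List (Vec Bool d × Vec Tiling (suc d))
  configurations d = cartesianProduct (vectors bools d) (vectors (tilings m) (suc d))

  wordOf : ∀ {d} → Vec Bool d × Vec Tiling (suc d) → List ℕ
  wordOf (bs , Ms) = layered (square ∷ assemble bs Ms) 1

  ∈-configurations⁻ : ∀ {d bs Ms} → (bs , Ms) ∈ configurations d → Middles Ms
  ∈-configurations⁻ {d} i =
    VecAll.map (∈-tilings⁻ m) (∈-vectors⁻ (suc d) (proj₂ (∈-cartesianProduct⁻ (vectors bools d) _ i)))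

  ∈-configurations⁺ : ∀ {d} {bs : Vec Bool d} {Ms} → Middles Ms → (bs , Ms) ∈ configurations d
  ∈-configurations⁺ es = ∈-cartesianProduct⁺ (∈-vectors⁺ (VecAll.universal ∈-bools _))
    (∈-vectors⁺ (VecAll.map (λ {M} e → subst (λ k → M ∈ tilings k) e (∈-tilings⁺ M)) es))

  diamondWordsOf : ∀ d → List (List ℕ)
  diamondWordsOf d = map wordOf (configurations d)

  diamondWordsOf-unique : ∀ d → Unique (diamondWordsOf d)
  diamondWordsOf-unique d = map-unique wordOf
    (cartesianProduct⁺ (vectors-unique bools-unique d) (vectors-unique (tilings-unique m) (suc d)))
    λ { {bs , _} {bs′ , _} i j eq → uncurry (cong₂ _,_)
          (assemble-injective {bs = bs} {bs′} (∈-configurations⁻ i) (∈-configurations⁻ j)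
                              (∷-injectiveʳ (layered-injective {square ∷ _} {square ∷ _} 1 eq))) }

  labelCount : ℕ → ℕ
  labelCount d = V * suc d

  size-wordOf : ∀ {d} (bs : Vec Bool d) Ms → Middles Ms → size (square ∷ assemble bs Ms) ≡ labelCount d
  size-wordOf {d} bs Ms es = trans (cong suc (size-assemble bs Ms es)) (*-comm (suc d) V)

  isDiamondWord : ∀ d → List ℕ → Bool
  isDiamondWord d w = diamondsOK V (suc d) w ∧ avoidsAll P231-312-321 w

  ∈-diamondWords⁻ : ∀ d {w} → w ∈ diamondWords V (suc d) P231-312-321 → w ∈ diamondWordsOf d
  ∈-diamondWords⁻ d {w} i
    with w∈perms , ok ← ∈-filter⁻ (λ w → T? (isDiamondWord d w)) {xs = perms (oneTo (labelCount d))} i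
    with diamond , avoiding ← ∧-elim {diamondsOK V (suc d) w} ok
    with t , st , refl ← avoider⇒layered 1 (labelCount d) w
                           (subst (w ↭_) (oneTo≡range (labelCount d)) (∈-perms⇒↭ _ w∈perms))
                           (avoidsAll⇒Avoids231-312-321 w avoiding)
    with bs , Ms , es , refl ← diamondWord⇒assembled d t (trans st (*-comm V (suc d))) diamond =
    ∈-map⁺ wordOf (∈-configurations⁺ {bs = bs} es)

  ∈-diamondWords⁺ : ∀ d {w} → w ∈ diamondWordsOf d → w ∈ diamondWords V (suc d) P231-312-321
  ∈-diamondWords⁺ d i with (bs , Ms) , j , refl ← ∈-map⁻ wordOf i =
    ∈-filter⁺ (λ w → T? (isDiamondWord d w)) (↭⇒∈-perms (oneTo (labelCount d)) word↭)
      (∧-intro (assembled⇒diamondWord bs Ms es)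
               (Avoids231-312-321⇒avoidsAll _ (layered-avoids (square ∷ assemble bs Ms) 1)))
    where
    es = ∈-configurations⁻ j
    word↭ : wordOf (bs , Ms) ↭ oneTo (labelCount d)
    word↭ = subst (wordOf (bs , Ms) ↭_)
                  (trans (cong (range 1) (size-wordOf bs Ms es)) (sym (oneTo≡range (labelCount d))))
                  (layered-↭ (square ∷ assemble bs Ms) 1)

  diamondWords↭ : ∀ d → diamondWords V (suc d) P231-312-321 ↭ diamondWordsOf d
  diamondWords↭ d = ∼bag⇒↭ (unique∧set⇒bag
    (filter⁺ (λ w → T? (isDiamondWord d w))
             (perms-unique (subst Unique (sym (oneTo≡range (labelCount d))) (range-unique 1 (labelCount d)))))
    (diamondWordsOf-unique d)
    (mk⇔ (∈-diamondWords⁻ d) (∈-diamondWords⁺ d)))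

  weightCount-bools : ∀ n → weightCount (dominoes ∘′ separator) bools n ≡ onePlusX n
  weightCount-bools zero = refl
  weightCount-bools (suc zero) = refl
  weightCount-bools (suc (suc n)) = refl

  des-wordOf : ∀ {d} (c : Vec Bool d × Vec Tiling (suc d)) →
    des (wordOf c) ≡ separatorWeight (proj₁ c) + middleWeight (proj₂ c)
  des-wordOf (bs , Ms) = trans (des-∷-layered (assemble bs Ms) (s≤s z≤n)) (dominoes-assemble bs Ms)

theorem4p5 : (v d : ℕ) → 4 ≤ v → 1 ≤ d →
    (n : ℕ) → lhsCoeff v d P231-312-321 n ≡ rhs v d n
theorem4p5 (suc (suc m)) (suc d) _ _ n = begin
  weightCount des (diamondWords V (suc d) P231-312-321) n
    ≡⟨ countᵇ-↭ _ (diamondWords↭ d) ⟩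
  weightCount des (map wordOf (configurations d)) n
    ≡⟨ countᵇ-map _ wordOf (configurations d) ⟩
  weightCount (des ∘′ wordOf) (configurations d) n
    ≡⟨ countᵇ-cong (configurations d) (λ {c} _ → cong (_≡ᵇ n) (des-wordOf c)) ⟩
  weightCount (λ (bs , Ms) → separatorWeight bs + middleWeight Ms) (configurations d) n
    ≡⟨ weightCount-cartesianProduct separatorWeight middleWeight (vectors bools d) (vectors (tilings m) (suc d)) n ⟩
  polyMul (weightCount separatorWeight (vectors bools d)) (weightCount middleWeight (vectors (tilings m) (suc d))) n
    ≡⟨ polyMul-cong (λ i → trans (weightCount-vectors _ bools d i) (polyPow-cong weightCount-bools d i))
                    (λ i → trans (weightCount-vectors _ (tilings m) (suc d) i)
                                 (polyPow-cong (weightCount-tilings≡fibPoly m) (suc d) i)) n ⟩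
  rhs V (suc d) n ∎
  where
  open ≡-Reasoning
  open Enumeration m
theorem4p5 (suc zero) _ (s≤s ()) _ _
theorem4p5 _ zero _ () _
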